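{- For $d\ge1$ and $e\ge2$, let $V_1(d,e)$ denote the eigenspace $V_1$ of the Hamming graph $H(d,e)$ with its Norton product. Then $V_1(d,e)$ is isomorphic, as an algebra, to the direct product of $d$ copies of $V_1(1,e)$.
   Context: $H(d,e)$: vertex set $X$ = words of length $d$ over $\{1,\dots,e\}$, adjacent iff differing in exactly one position (so $H(1,e)$ is the complete graph $K_e$). $V_1$ is the eigenspace in $\mathbb R^X$ of the second largest eigenvalue of the adjacency matrix, $\pi_1$ the orthogonal projection onto it, and the Norton product is $u\star v=\pi_1(u\cdot v)$ (entrywise product). The direct product of algebras has componentwise operations.
   Formalization: The eigenspaces $V_1$ are taken in ℚ^X rather than $\mathbb R^X$, so the algebra isomorphism is ℚ-linear. -}

module Defs where

open import Data.Nat using (ℕ; zero; suc)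
open import Data.Fin using (Fin)
open import Data.Fin.Properties using () renaming (_≟_ to _≟ᶠ_)
open import Data.Vec using (Vec; []; _∷_)
open import Data.List using (List; []; _∷_; map; concatMap; foldr; filter)
open import Data.List.Base using (allFin)
open import Data.Rational using (ℚ; 0ℚ; _+_; _*_; _-_; _<_)
open import Data.Product using (Σ; ∃; _×_; _,_; proj₁)
open import Relation.Binary.PropositionalEquality using (_≡_)
open import Relation.Nullary using (¬_; yes; no)
open import Relation.Nullary.Decidable using (⌊_⌋)
open import Data.Bool using (Bool; true; false)

Word : ℕ → ℕ → Set
Word d e = Vec (Fin e) d

allWords : (d e : ℕ) → List (Word d e)
allWords zero    e = [] ∷ []
allWords (suc d) e = concatMap (λ a → map (a ∷_) (allWords d e)) (allFin e)

dist : {d e : ℕ} → Word d e → Word d e → ℕ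
dist []       []       = 0
dist (a ∷ x) (b ∷ y) with a ≟ᶠ b
... | yes _ = dist x y
... | no  _ = suc (dist x y)

adjacent? : {d e : ℕ} → Word d e → Word d e → Bool
adjacent? x y with dist x y
... | 1 = true
... | _ = false

Fun : ℕ → ℕ → Set
Fun d e = Word d e → ℚ

sumℚ : List ℚ → ℚ
sumℚ = foldr _+_ 0ℚ

adj : (d e : ℕ) → Fun d e → Fun d e
adj d e f x = sumℚ (map f (filter (λ y → adjacent? x y Data.Bool.≟ true) (allWords d e)))

inner : (d e : ℕ) → Fun d e → Fun d e → ℚ
inner d e f g = sumℚ (map (λ x → f x * g x) (allWords d e))

-- f is an eigenvector for eigenvalue λ (possibly zero)
IsEigen : (d e : ℕ) → ℚ → Fun d e → Set
IsEigen d e λ′ f = ∀ x → adj d e f x ≡ λ′ * f x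

IsEigenvalue : (d e : ℕ) → ℚ → Set
IsEigenvalue d e λ′ = Σ (Fun d e) λ f → IsEigen d e λ′ f × Σ (Word d e) (λ x → ¬ (f x ≡ 0ℚ))

IsSecondLargest : (d e : ℕ) → ℚ → Set
IsSecondLargest d e λ′ =
  IsEigenvalue d e λ′ ×
  Σ ℚ (λ μ → IsEigenvalue d e μ × λ′ < μ ×
             (∀ ν → IsEigenvalue d e ν → λ′ < ν → ν ≡ μ))

InV₁ : (d e : ℕ) → Fun d e → Set
InV₁ d e f = Σ ℚ λ λ′ → IsSecondLargest d e λ′ × IsEigen d e λ′ f

V₁ : ℕ → ℕ → Set
V₁ d e = Σ (Fun d e) (InV₁ d e)

_≈V_ : {d e : ℕ} → V₁ d e → V₁ d e → Set
u ≈V v = ∀ x → proj₁ u x ≡ proj₁ v x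

-- Norton product, expressed as the graph of u ⋆ v = π₁(u·v):
-- w = π₁(u·v) iff w ∈ V₁ and u·v − w is orthogonal to V₁.
IsNorton : (d e : ℕ) → V₁ d e → V₁ d e → V₁ d e → Set
IsNorton d e (u , _) (v , _) (w , _) =
  (z : V₁ d e) → inner d e (λ x → u x * v x - w x) (proj₁ z) ≡ 0ℚ

lin : {d e : ℕ} → ℚ → Fun d e → ℚ → Fun d e → Fun d e
lin a u b v x = a * u x + b * v x

record AlgIsoToPower (d e : ℕ) : Set where
  field
    φ        : V₁ d e → (Fin d → V₁ 1 e)
    φ-cong   : ∀ u v → u ≈V v → ∀ i → φ u i ≈V φ v i
    φ-linear : ∀ (a b : ℚ) (u v w : V₁ d e) →
               (∀ x → proj₁ w x ≡ lin a (proj₁ u) b (proj₁ v) x) →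
               ∀ i y → proj₁ (φ w i) y ≡ lin a (proj₁ (φ u i)) b (proj₁ (φ v i)) y
    φ-inj    : ∀ u v → (∀ i → φ u i ≈V φ v i) → u ≈V v
    φ-surj   : ∀ (t : Fin d → V₁ 1 e) → Σ (V₁ d e) λ u → ∀ i → φ u i ≈V t i
    φ-mult   : ∀ u v w → IsNorton d e u v w →
               ∀ i → IsNorton 1 e (φ u i) (φ v i) (φ w i)

-- Above θ₁ = d(e − 1) − e the only eigenvalue of H(d,e) is its valency θ₀ = d(e − 1), the
-- θ₀-eigenvectors are constant, and the θ₁-eigenvectors are exactly the additive functions
-- x ↦ Σᵢ gᵢ(xᵢ) with every gᵢ of mean zero. All three facts come from one induction on d: an
-- eigenvector f of H(d+1,e) for ν splits as f(a∷x) = (f(a∷x) − mean_b f(b∷x)) + mean_b f(b∷x),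
-- and the deviations and the fibre mean are eigenvectors of H(d,e) for ν + 1 and ν − (e − 1).
-- Hence reading off the coordinate functions gᵢ of u ∈ V₁ is a linear bijection
-- V₁(d,e) ≅ V₁(1,e)^d. It is multiplicative because for zero-mean families every product of
-- distinct coordinates sums to zero, leaving e·⟨uv − w, Σᵢ Gᵢ(xᵢ)⟩ = e^d Σᵢ ⟨uᵢvᵢ − wᵢ, Gᵢ⟩.

{-# OPTIONS --safe #-}
module Submission where

open import Defs
open import Algebra.Bundles using (CommutativeMonoid)
open import Data.Bool as Bool using (Bool; true; false; if_then_else_)
open import Data.Fin using (Fin; zero; suc)
open import Data.Fin.Properties using (suc-injective) renaming (_≟_ to _≟ᶠ_)
open import Data.List using (List; []; _∷_; map; concatMap; filter; _++_; allFin)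
open import Data.List.Properties using (map-tabulate; map-∘)
open import Data.Nat using (ℕ; zero; suc; _≤_; s≤s)
open import Data.Product using (Σ; _×_; _,_; proj₁; proj₂)
open import Data.Rational
  using (ℚ; 0ℚ; 1ℚ; _+_; _*_; _-_; -_; 1/_; _<_; NonZero; Positive; NonNegative; ≢-nonZero; +-*-rawSemiring)
open import Data.Rational.Properties
open import Algebra.Definitions.RawSemiring +-*-rawSemiring as ℚ-semiring using (_^_)
open import Algebra.Properties.CommutativeSemigroup
  (CommutativeMonoid.commutativeSemigroup +-0-commutativeMonoid) using (interchange)
open import Data.Vec using ([]; _∷_; replicate; lookup; _[_]≔_)
open import Data.Vec.Functional using (updateAt)
open import Data.Vec.Functional.Properties using (updateAt-updates; updateAt-minimal)
open import Function using (_∘_)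
open import Level using (0ℓ)
open import Relation.Binary.Definitions using (tri<; tri≈; tri>)
open import Relation.Binary.PropositionalEquality
open import Relation.Nullary using (Dec; does; yes; no; contradiction)
open import Relation.Nullary.Decidable using (dec⇒maybe)
import Tactic.RingSolver.Core.AlmostCommutativeRing as ACR
open import Tactic.RingSolver using (solve-∀)

open ≡-Reasoning

private variable
  A B : Set

-- The solver compares normal forms; it needs the zero test to drop cancelled coefficients.
ℚ-ring : ACR.AlmostCommutativeRing 0ℓ 0ℓ
ℚ-ring = ACR.fromCommutativeRing +-*-commutativeRing (λ p → dec⇒maybe (0ℚ ≟ p))

p-q+q≡p : ∀ p q → p - q + q ≡ p
p-q+q≡p = solve-∀ ℚ-ring

p+q-q≡p : ∀ p q → p + q - q ≡ p
p+q-q≡p = solve-∀ ℚ-ring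

fromℕ : ℕ → ℚ
fromℕ n = n ℚ-semiring.× 1ℚ

r*p≡0⇒p≡0 : (r : ℚ) .{{_ : NonZero r}} {p : ℚ} → r * p ≡ 0ℚ → p ≡ 0ℚ
r*p≡0⇒p≡0 r {p} rp≡0 = begin
  p              ≡⟨ *-identityˡ p ⟨
  1ℚ * p         ≡⟨ cong (_* p) (*-inverseˡ r) ⟨
  1/ r * r * p   ≡⟨ *-assoc (1/ r) r p ⟩
  1/ r * (r * p) ≡⟨ cong (1/ r *_) rp≡0 ⟩
  1/ r * 0ℚ      ≡⟨ *-zeroʳ (1/ r) ⟩
  0ℚ             ∎

fromℕ-nonNegative : (n : ℕ) → NonNegative (fromℕ n)
fromℕ-nonNegative zero    = _
fromℕ-nonNegative (suc n) =
  pos⇒nonNeg (fromℕ (suc n)) {{pos+nonNeg⇒pos 1ℚ (fromℕ n) {{fromℕ-nonNegative n}}}}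

-- Finite sums

∑ : List A → (A → ℚ) → ℚ
∑ xs f = sumℚ (map f xs)

∑-cong : (xs : List A) {f g : A → ℚ} → (∀ x → f x ≡ g x) → ∑ xs f ≡ ∑ xs g
∑-cong []       f≗g = refl
∑-cong (x ∷ xs) f≗g = cong₂ _+_ (f≗g x) (∑-cong xs f≗g)

∑-zero : (xs : List A) → ∑ xs (λ _ → 0ℚ) ≡ 0ℚ
∑-zero []       = refl
∑-zero (x ∷ xs) = cong (0ℚ +_) (∑-zero xs)

∑-vanishes : (xs : List A) {f : A → ℚ} → (∀ x → f x ≡ 0ℚ) → ∑ xs f ≡ 0ℚ
∑-vanishes xs f≗0 = trans (∑-cong xs f≗0) (∑-zero xs)

∑-+ : (xs : List A) (f g : A → ℚ) → ∑ xs (λ x → f x + g x) ≡ ∑ xs f + ∑ xs g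
∑-+ []       f g = refl
∑-+ (x ∷ xs) f g = trans (cong ((f x + g x) +_) (∑-+ xs f g)) (interchange (f x) (g x) _ _)

∑-*ˡ : (xs : List A) (c : ℚ) (f : A → ℚ) → ∑ xs (λ x → c * f x) ≡ c * ∑ xs f
∑-*ˡ []       c f = sym (*-zeroʳ c)
∑-*ˡ (x ∷ xs) c f = trans (cong (c * f x +_) (∑-*ˡ xs c f)) (sym (*-distribˡ-+ c (f x) _))

∑-scaled-vanishes : (xs : List A) (c : ℚ) (f : A → ℚ) → ∑ xs f ≡ 0ℚ → ∑ xs (λ x → c * f x) ≡ 0ℚ
∑-scaled-vanishes xs c f ∑f≡0 = trans (∑-*ˡ xs c f) (trans (cong (c *_) ∑f≡0) (*-zeroʳ c))

∑-neg : (xs : List A) (f : A → ℚ) → ∑ xs (λ x → - f x) ≡ - ∑ xs f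
∑-neg []       f = refl
∑-neg (x ∷ xs) f = trans (cong (- f x +_) (∑-neg xs f)) (sym (neg-distrib-+ (f x) _))

∑-- : (xs : List A) (f g : A → ℚ) → ∑ xs (λ x → f x - g x) ≡ ∑ xs f - ∑ xs g
∑-- xs f g = trans (∑-+ xs f (λ x → - g x)) (cong (∑ xs f +_) (∑-neg xs g))

∑-++ : (xs ys : List A) (f : A → ℚ) → ∑ (xs ++ ys) f ≡ ∑ xs f + ∑ ys f
∑-++ []       ys f = sym (+-identityˡ _)
∑-++ (x ∷ xs) ys f = trans (cong (f x +_) (∑-++ xs ys f)) (sym (+-assoc (f x) _ _))

∑-comm : (xs : List A) (ys : List B) (F : A → B → ℚ) →
         ∑ xs (λ x → ∑ ys (F x)) ≡ ∑ ys (λ y → ∑ xs (λ x → F x y))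
∑-comm []       ys F = sym (∑-zero ys)
∑-comm (x ∷ xs) ys F = trans (cong (∑ ys (F x) +_) (∑-comm xs ys F))
                             (sym (∑-+ ys (F x) (λ y → ∑ xs (λ x → F x y))))

∑-filter : {P : A → Set} (P? : ∀ x → Dec (P x)) (xs : List A) (f : A → ℚ) →
           ∑ (filter P? xs) f ≡ ∑ xs (λ x → if does (P? x) then f x else 0ℚ)
∑-filter P? []       f = refl
∑-filter P? (x ∷ xs) f with does (P? x)
... | true  = cong (f x +_) (∑-filter P? xs f)
... | false = trans (∑-filter P? xs f) (sym (+-identityˡ _))

∑-map : (h : B → A) (ys : List B) (f : A → ℚ) → ∑ (map h ys) f ≡ ∑ ys (f ∘ h)
∑-map h ys f = cong sumℚ (sym (map-∘ ys))

∑-concatMap : (G : B → List A) (ys : List B) (f : A → ℚ) →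
              ∑ (concatMap G ys) f ≡ ∑ ys (λ y → ∑ (G y) f)
∑-concatMap G []       f = refl
∑-concatMap G (y ∷ ys) f = trans (∑-++ (G y) _ f) (cong (∑ (G y) f +_) (∑-concatMap G ys f))

∑Fin : {n : ℕ} → (Fin n → ℚ) → ℚ
∑Fin {n} = ∑ (allFin n)

∑Word : (d : ℕ) {e : ℕ} → (Word d e → ℚ) → ℚ
∑Word d {e} = ∑ (allWords d e)

∑Fin-suc : {n : ℕ} (f : Fin (suc n) → ℚ) → ∑Fin f ≡ f zero + ∑Fin (f ∘ suc)
∑Fin-suc f = cong (λ xs → f zero + sumℚ xs)
                  (trans (map-tabulate suc f) (sym (map-tabulate (λ i → i) (f ∘ suc))))

∑Word-suc : (d : ℕ) {e : ℕ} (f : Word (suc d) e → ℚ) →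
            ∑Word (suc d) f ≡ ∑Fin (λ a → ∑Word d (λ x → f (a ∷ x)))
∑Word-suc d {e} f = trans (∑-concatMap (λ a → map (a ∷_) (allWords d e)) (allFin e) f)
                          (∑-cong (allFin e) (λ a → ∑-map (a ∷_) (allWords d e) f))

∑Fin-const : (n : ℕ) (c : ℚ) → ∑Fin {n} (λ _ → c) ≡ fromℕ n * c
∑Fin-const zero    c = sym (*-zeroˡ c)
∑Fin-const (suc n) c = begin
  ∑Fin {suc n} (λ _ → c)  ≡⟨ ∑Fin-suc {n} (λ _ → c) ⟩
  c + ∑Fin {n} (λ _ → c)  ≡⟨ cong (c +_) (∑Fin-const n c) ⟩
  c + fromℕ n * c         ≡⟨ cong (_+ fromℕ n * c) (*-identityˡ c) ⟨
  1ℚ * c + fromℕ n * c    ≡⟨ *-distribʳ-+ c 1ℚ (fromℕ n) ⟨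
  fromℕ (suc n) * c       ∎

∑Word-const : (d e : ℕ) (c : ℚ) → ∑Word d {e} (λ _ → c) ≡ fromℕ e ^ d * c
∑Word-const zero    e c = trans (+-identityʳ c) (sym (*-identityˡ c))
∑Word-const (suc d) e c = begin
  ∑Word (suc d) {e} (λ _ → c)                   ≡⟨ ∑Word-suc d {e} (λ _ → c) ⟩
  ∑Fin {e} (λ _ → ∑Word d {e} (λ _ → c))      ≡⟨ ∑-cong (allFin e) (λ _ → ∑Word-const d e c) ⟩
  ∑Fin {e} (λ _ → E ^ d * c)                    ≡⟨ ∑Fin-const e (E ^ d * c) ⟩
  E * (E ^ d * c)                               ≡⟨ *-assoc E (E ^ d) c ⟨
  E ^ suc d * c                                 ∎
  where E = fromℕ e

∑Fin-point : {n : ℕ} (f : Fin n → ℚ) (a : Fin n) → (∀ b → b ≢ a → f b ≡ 0ℚ) → ∑Fin f ≡ f a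
∑Fin-point {suc n} f zero    f≡0 = begin
  ∑Fin f                  ≡⟨ ∑Fin-suc f ⟩
  f zero + ∑Fin (f ∘ suc) ≡⟨ cong (f zero +_) (∑-vanishes (allFin n) (λ b → f≡0 (suc b) λ ())) ⟩
  f zero + 0ℚ             ≡⟨ +-identityʳ (f zero) ⟩
  f zero                  ∎
∑Fin-point {suc n} f (suc a) f≡0 = begin
  ∑Fin f                  ≡⟨ ∑Fin-suc f ⟩
  f zero + ∑Fin (f ∘ suc) ≡⟨ cong (_+ ∑Fin (f ∘ suc)) (f≡0 zero λ ()) ⟩
  0ℚ + ∑Fin (f ∘ suc)     ≡⟨ +-identityˡ (∑Fin (f ∘ suc)) ⟩
  ∑Fin (f ∘ suc)          ≡⟨ ∑Fin-point (f ∘ suc) a (λ b b≢a → f≡0 (suc b) (b≢a ∘ suc-injective)) ⟩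
  f (suc a)               ∎

∑Word-point : (d : ℕ) {e : ℕ} (f : Word d e → ℚ) (x : Word d e) →
              (∀ y → y ≢ x → f y ≡ 0ℚ) → ∑Word d f ≡ f x
∑Word-point zero    f []      _   = +-identityʳ _
∑Word-point (suc d) {e} f (a ∷ x) f≡0 = begin
  ∑Word (suc d) f
    ≡⟨ ∑Word-suc d f ⟩
  ∑Fin (λ b → ∑Word d (λ y → f (b ∷ y)))
    ≡⟨ ∑Fin-point _ a (λ b b≢a → ∑-vanishes (allWords d e) (λ y → f≡0 (b ∷ y) (b≢a ∘ head-≡))) ⟩
  ∑Word d (λ y → f (a ∷ y))
    ≡⟨ ∑Word-point d _ x (λ y y≢x → f≡0 (a ∷ y) (y≢x ∘ tail-≡)) ⟩
  f (a ∷ x) ∎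
  where
  head-≡ : ∀ {b y} → _≡_ {A = Word (suc d) _} (b ∷ y) (a ∷ x) → b ≡ a
  head-≡ refl = refl
  tail-≡ : ∀ {y} → _≡_ {A = Word (suc d) _} (a ∷ y) (a ∷ x) → y ≡ x
  tail-≡ refl = refl

∑Fin-agreeExcept : {n : ℕ} (f g : Fin n → ℚ) (a : Fin n) → (∀ b → b ≢ a → f b ≡ g b) →
                   ∑Fin f ≡ ∑Fin g - g a + f a
∑Fin-agreeExcept {n} f g a f≡g = begin
  ∑Fin f                           ≡⟨ split (∑Fin f) (∑Fin g) ⟩
  ∑Fin g + (∑Fin f - ∑Fin g)       ≡⟨ cong (∑Fin g +_) (∑-- (allFin n) f g) ⟨
  ∑Fin g + ∑Fin (λ b → f b - g b)  ≡⟨ cong (∑Fin g +_) (∑Fin-point _ a difference-vanishes) ⟩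
  ∑Fin g + (f a - g a)             ≡⟨ regroup (∑Fin g) (f a) (g a) ⟩
  ∑Fin g - g a + f a               ∎
  where
  difference-vanishes : ∀ b → b ≢ a → f b - g b ≡ 0ℚ
  difference-vanishes b b≢a = trans (cong (_- g b) (f≡g b b≢a)) (+-inverseʳ (g b))
  split : ∀ s t → s ≡ t + (s - t)
  split = solve-∀ ℚ-ring
  regroup : ∀ s x y → s + (x - y) ≡ s - y + x
  regroup = solve-∀ ℚ-ring

-- The Hamming graph

-- adj d e f x unfolds to ∑ (neighbours x) f, so the lemmas on ∑ apply to adj directly.
neighbours : {d e : ℕ} → Word d e → List (Word d e)
neighbours {d} {e} x = filter (λ y → adjacent? x y Bool.≟ true) (allWords d e)

isOne : ℕ → Bool
isOne 1 = true
isOne _ = false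

adjacent?≡isOne∘dist : {d e : ℕ} (x y : Word d e) → adjacent? x y ≡ isOne (dist x y)
adjacent?≡isOne∘dist x y with dist x y
... | 0           = refl
... | 1           = refl
... | suc (suc _) = refl

dist-cons-≡ : {d e : ℕ} (a : Fin e) (x y : Word d e) → dist (a ∷ x) (a ∷ y) ≡ dist x y
dist-cons-≡ a x y with a ≟ᶠ a
... | yes _   = refl
... | no  a≢a = contradiction refl a≢a

dist-cons-≢ : {d e : ℕ} {a b : Fin e} (x y : Word d e) → a ≢ b → dist (a ∷ x) (b ∷ y) ≡ suc (dist x y)
dist-cons-≢ {a = a} {b} x y a≢b with a ≟ᶠ b
... | yes a≡b = contradiction a≡b a≢b
... | no  _   = refl

dist-self : {d e : ℕ} (x : Word d e) → dist x x ≡ 0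
dist-self []      = refl
dist-self (a ∷ x) = trans (dist-cons-≡ a x x) (dist-self x)

dist≡0⇒≡ : {d e : ℕ} (x y : Word d e) → dist x y ≡ 0 → x ≡ y
dist≡0⇒≡ []      []      _ = refl
dist≡0⇒≡ (a ∷ x) (b ∷ y) d≡0 with a ≟ᶠ b
... | yes refl = cong (a ∷_) (dist≡0⇒≡ x y d≡0)
dist≡0⇒≡ (a ∷ x) (b ∷ y) () | no _

adjacent?-cons-≡ : {d e : ℕ} (a : Fin e) (x y : Word d e) → adjacent? (a ∷ x) (a ∷ y) ≡ adjacent? x y
adjacent?-cons-≡ a x y = begin
  adjacent? (a ∷ x) (a ∷ y)     ≡⟨ adjacent?≡isOne∘dist (a ∷ x) (a ∷ y) ⟩
  isOne (dist (a ∷ x) (a ∷ y))  ≡⟨ cong isOne (dist-cons-≡ a x y) ⟩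
  isOne (dist x y)              ≡⟨ adjacent?≡isOne∘dist x y ⟨
  adjacent? x y                 ∎

adjacent?-cons-≢ : {d e : ℕ} {a b : Fin e} (x y : Word d e) → a ≢ b →
                   adjacent? (a ∷ x) (b ∷ y) ≡ isOne (suc (dist x y))
adjacent?-cons-≢ {a = a} {b} x y a≢b =
  trans (adjacent?≡isOne∘dist (a ∷ x) (b ∷ y)) (cong isOne (dist-cons-≢ x y a≢b))

does-≟-true : (b : Bool) → does (b Bool.≟ true) ≡ b
does-≟-true true  = refl
does-≟-true false = refl

adj-as-∑Word : (d e : ℕ) (f : Fun d e) (x : Word d e) →
               adj d e f x ≡ ∑Word d (λ y → if adjacent? x y then f y else 0ℚ)
adj-as-∑Word d e f x =
  trans (∑-filter (λ y → adjacent? x y Bool.≟ true) (allWords d e) f)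
        (∑-cong (allWords d e) (λ y → cong (λ b → if b then f y else 0ℚ) (does-≟-true (adjacent? x y))))

adj-cons : (d e : ℕ) (f : Fun (suc d) e) (a : Fin e) (x : Word d e) →
           adj (suc d) e f (a ∷ x) ≡ ∑Fin (λ b → f (b ∷ x)) - f (a ∷ x) + adj d e (λ y → f (a ∷ y)) x
adj-cons d e f a x = begin
  adj (suc d) e f (a ∷ x)                       ≡⟨ adj-as-∑Word (suc d) e f (a ∷ x) ⟩
  ∑Word (suc d) neighbour-values                ≡⟨ ∑Word-suc d neighbour-values ⟩
  ∑Fin slice                                    ≡⟨ ∑Fin-agreeExcept slice (λ b → f (b ∷ x)) a other-slice ⟩
  ∑Fin (λ b → f (b ∷ x)) - f (a ∷ x) + slice a  ≡⟨ cong (∑Fin (λ b → f (b ∷ x)) - f (a ∷ x) +_) own-slice ⟩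
  ∑Fin (λ b → f (b ∷ x)) - f (a ∷ x) + adj d e (λ y → f (a ∷ y)) x ∎
  where
  neighbour-values : Fun (suc d) e
  neighbour-values y = if adjacent? (a ∷ x) y then f y else 0ℚ

  slice : Fin e → ℚ
  slice b = ∑Word d (λ y → neighbour-values (b ∷ y))

  own-slice : slice a ≡ adj d e (λ y → f (a ∷ y)) x
  own-slice =
    trans (∑-cong (allWords d e) (λ y → cong (λ t → if t then f (a ∷ y) else 0ℚ) (adjacent?-cons-≡ a x y)))
          (sym (adj-as-∑Word d e (λ y → f (a ∷ y)) x))

  other-slice : ∀ b → b ≢ a → slice b ≡ f (b ∷ x)
  other-slice b b≢a = trans (∑Word-point d _ x off-x) (cong (λ t → if t then f (b ∷ x) else 0ℚ) at-x)
    where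
    off-x : ∀ y → y ≢ x → neighbour-values (b ∷ y) ≡ 0ℚ
    off-x y y≢x rewrite adjacent?-cons-≢ x y (b≢a ∘ sym) with dist x y in eq
    ... | zero  = contradiction (sym (dist≡0⇒≡ x y eq)) y≢x
    ... | suc _ = refl
    at-x : adjacent? (a ∷ x) (b ∷ x) ≡ true
    at-x = trans (adjacent?-cons-≢ x x (b≢a ∘ sym)) (cong (isOne ∘ suc) (dist-self x))

-- Additive functions x ↦ Σᵢ gᵢ(xᵢ)

ZeroMean : {d e : ℕ} → (Fin d → Fin e → ℚ) → Set
ZeroMean g = ∀ i → ∑Fin (g i) ≡ 0ℚ

additive : {d e : ℕ} → (Fin d → Fin e → ℚ) → Fun d e
additive g []      = 0ℚ
additive g (a ∷ x) = g zero a + additive (g ∘ suc) x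

additive-cong : {d e : ℕ} {g h : Fin d → Fin e → ℚ} → (∀ i a → g i a ≡ h i a) →
                ∀ x → additive g x ≡ additive h x
additive-cong g≗h []      = refl
additive-cong g≗h (a ∷ x) = cong₂ _+_ (g≗h zero a) (additive-cong (g≗h ∘ suc) x)

additive-linear : {d e : ℕ} (r s : ℚ) (g h : Fin d → Fin e → ℚ) (x : Word d e) →
                  additive (λ i a → r * g i a + s * h i a) x ≡ r * additive g x + s * additive h x
additive-linear r s g h []      = sym (cong₂ _+_ (*-zeroʳ r) (*-zeroʳ s))
additive-linear r s g h (a ∷ x) = begin
  r * g zero a + s * h zero a + additive (λ i b → r * g (suc i) b + s * h (suc i) b) x
    ≡⟨ cong (r * g zero a + s * h zero a +_) (additive-linear r s (g ∘ suc) (h ∘ suc) x) ⟩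
  r * g zero a + s * h zero a + (r * additive (g ∘ suc) x + s * additive (h ∘ suc) x)
    ≡⟨ regroup r s (g zero a) (h zero a) _ _ ⟩
  r * (g zero a + additive (g ∘ suc) x) + s * (h zero a + additive (h ∘ suc) x) ∎
  where
  regroup : ∀ r s p q X Y → r * p + s * q + (r * X + s * Y) ≡ r * (p + X) + s * (q + Y)
  regroup = solve-∀ ℚ-ring

additive-zero : {d e : ℕ} (x : Word d e) → additive (λ _ _ → 0ℚ) x ≡ 0ℚ
additive-zero []      = refl
additive-zero (a ∷ x) = cong (0ℚ +_) (additive-zero x)

additive-update : {d e : ℕ} (g : Fin d → Fin e → ℚ) (x : Word d e) (i : Fin d) (a : Fin e) →
                  additive g (x [ i ]≔ a) ≡ g i a + (additive g x - g i (lookup x i))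
additive-update g (b ∷ x) zero    a = shift (g zero a) (g zero b) (additive (g ∘ suc) x)
  where
  shift : ∀ p q X → p + X ≡ p + (q + X - q)
  shift = solve-∀ ℚ-ring
additive-update {e = e} g (b ∷ x) (suc i) a = begin
  g zero b + additive (g ∘ suc) (x [ i ]≔ a)   ≡⟨ cong (g zero b +_) (additive-update (g ∘ suc) x i a) ⟩
  g zero b + (g (suc i) a + (X - g (suc i) c)) ≡⟨ shift (g zero b) (g (suc i) a) X (g (suc i) c) ⟩
  g (suc i) a + (g zero b + X - g (suc i) c)   ∎
  where
  X : ℚ
  X = additive (g ∘ suc) x
  c : Fin e
  c = lookup x i
  shift : ∀ p q X r → p + (q + (X - r)) ≡ q + (p + X - r)
  shift = solve-∀ ℚ-ring

∑Word-additive : (d : ℕ) {e : ℕ} (g : Fin d → Fin e → ℚ) → ZeroMean g → ∑Word d (additive g) ≡ 0ℚ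
∑Word-additive zero        g _          = refl
∑Word-additive (suc d) {e} g g-zeroMean = begin
  ∑Word (suc d) (additive g)
    ≡⟨ ∑Word-suc d (additive g) ⟩
  ∑Fin (λ a → ∑Word d (λ y → g zero a + additive (g ∘ suc) y))
    ≡⟨ ∑-cong (allFin e) row ⟩
  ∑Fin (λ a → fromℕ e ^ d * g zero a)
    ≡⟨ ∑-scaled-vanishes (allFin e) (fromℕ e ^ d) (g zero) (g-zeroMean zero) ⟩
  0ℚ ∎
  where
  row : ∀ a → ∑Word d (λ y → g zero a + additive (g ∘ suc) y) ≡ fromℕ e ^ d * g zero a
  row a = begin
    ∑Word d (λ y → g zero a + additive (g ∘ suc) y)
      ≡⟨ ∑-+ (allWords d e) (λ _ → g zero a) (additive (g ∘ suc)) ⟩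
    ∑Word d {e} (λ _ → g zero a) + ∑Word d (additive (g ∘ suc))
      ≡⟨ cong₂ _+_ (∑Word-const d e (g zero a)) (∑Word-additive d (g ∘ suc) (g-zeroMean ∘ suc)) ⟩
    fromℕ e ^ d * g zero a + 0ℚ
      ≡⟨ +-identityʳ _ ⟩
    fromℕ e ^ d * g zero a ∎

single : {d e : ℕ} → Fin d → (Fin e → ℚ) → Fin d → Fin e → ℚ
single i q = updateAt (λ _ _ → 0ℚ) i (λ _ → q)

single-zeroMean : {d e : ℕ} (i : Fin d) (q : Fin e → ℚ) → ∑Fin q ≡ 0ℚ → ZeroMean (single i q)
single-zeroMean {e = e} i q ∑q≡0 j with j ≟ᶠ i
... | yes refl = trans (cong (∑Fin {e}) (updateAt-updates i {λ _ → q} (λ _ _ → 0ℚ))) ∑q≡0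
... | no  j≢i  = trans (cong (∑Fin {e}) (updateAt-minimal j i {λ _ → q} (λ _ _ → 0ℚ) j≢i)) (∑-zero (allFin e))

-- The Norton pairing of additive functions

∑-shiftedProduct : (xs : List A) (p q r : ℚ) (U V W : A → ℚ) → ∑ xs U ≡ 0ℚ → ∑ xs V ≡ 0ℚ →
                   ∑ xs (λ x → (p + U x) * (q + V x) - (r + W x))
                   ≡ ∑ xs (λ _ → p * q - r) + ∑ xs (λ x → U x * V x - W x)
∑-shiftedProduct xs p q r U V W ∑U≡0 ∑V≡0 = begin
  ∑ xs (λ x → (p + U x) * (q + V x) - (r + W x))
    ≡⟨ ∑-cong xs (λ x → expand p q r (U x) (V x) (W x)) ⟩
  ∑ xs (λ x → p * q - r + (U x * V x - W x) + (p * V x + q * U x))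
    ≡⟨ ∑-+ xs (λ x → p * q - r + (U x * V x - W x)) (λ x → p * V x + q * U x) ⟩
  ∑ xs (λ x → p * q - r + (U x * V x - W x)) + ∑ xs (λ x → p * V x + q * U x)
    ≡⟨ cong₂ _+_ (∑-+ xs (λ _ → p * q - r) (λ x → U x * V x - W x)) cross-terms ⟩
  ∑ xs (λ _ → p * q - r) + ∑ xs (λ x → U x * V x - W x) + 0ℚ
    ≡⟨ +-identityʳ _ ⟩
  ∑ xs (λ _ → p * q - r) + ∑ xs (λ x → U x * V x - W x) ∎
  where
  expand : ∀ p q r u v w → (p + u) * (q + v) - (r + w) ≡ p * q - r + (u * v - w) + (p * v + q * u)
  expand = solve-∀ ℚ-ring
  cross-terms : ∑ xs (λ x → p * V x + q * U x) ≡ 0ℚ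
  cross-terms = trans (∑-+ xs (λ x → p * V x) (λ x → q * U x))
                      (cong₂ _+_ (∑-scaled-vanishes xs p V ∑V≡0) (∑-scaled-vanishes xs q U ∑U≡0))

∑-*-affine : (xs : List A) (s c : A → ℚ) (N K : ℚ) → ∑ xs s ≡ 0ℚ →
             ∑ xs (λ x → s x * (N * c x + K)) ≡ N * ∑ xs (λ x → c x * s x)
∑-*-affine xs s c N K ∑s≡0 = begin
  ∑ xs (λ x → s x * (N * c x + K))
    ≡⟨ ∑-cong xs (λ x → distribute (s x) N (c x) K) ⟩
  ∑ xs (λ x → N * (c x * s x) + K * s x)
    ≡⟨ ∑-+ xs (λ x → N * (c x * s x)) (λ x → K * s x) ⟩
  ∑ xs (λ x → N * (c x * s x)) + ∑ xs (λ x → K * s x)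
    ≡⟨ cong₂ _+_ (∑-*ˡ xs N (λ x → c x * s x)) (∑-scaled-vanishes xs K s ∑s≡0) ⟩
  N * ∑ xs (λ x → c x * s x) + 0ℚ
    ≡⟨ +-identityʳ _ ⟩
  N * ∑ xs (λ x → c x * s x) ∎
  where
  distribute : ∀ s N c K → s * (N * c + K) ≡ N * (c * s) + K * s
  distribute = solve-∀ ℚ-ring

∑∑-*-split : (xs : List A) (ys : List B) (F : A → B → ℚ) (s : A → ℚ) (t : B → ℚ) →
             ∑ xs (λ a → ∑ ys (λ b → F a b * (s a + t b)))
             ≡ ∑ xs (λ a → s a * ∑ ys (F a)) + ∑ ys (λ b → t b * ∑ xs (λ a → F a b))
∑∑-*-split xs ys F s t = begin
  ∑ xs (λ a → ∑ ys (λ b → F a b * (s a + t b)))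
    ≡⟨ ∑-cong xs (λ a → trans (∑-cong ys (λ b → distribute (F a b) (s a) (t b)))
                              (∑-+ ys (λ b → s a * F a b) (λ b → t b * F a b))) ⟩
  ∑ xs (λ a → ∑ ys (λ b → s a * F a b) + ∑ ys (λ b → t b * F a b))
    ≡⟨ ∑-+ xs (λ a → ∑ ys (λ b → s a * F a b)) (λ a → ∑ ys (λ b → t b * F a b)) ⟩
  ∑ xs (λ a → ∑ ys (λ b → s a * F a b)) + ∑ xs (λ a → ∑ ys (λ b → t b * F a b))
    ≡⟨ cong₂ _+_ (∑-cong xs (λ a → ∑-*ˡ ys (s a) (F a)))
                 (trans (∑-comm xs ys (λ a b → t b * F a b))
                        (∑-cong ys (λ b → ∑-*ˡ xs (t b) (λ a → F a b)))) ⟩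
  ∑ xs (λ a → s a * ∑ ys (F a)) + ∑ ys (λ b → t b * ∑ xs (λ a → F a b)) ∎
  where
  distribute : ∀ f s t → f * (s + t) ≡ s * f + t * f
  distribute = solve-∀ ℚ-ring

inner-congˡ : (d e : ℕ) {f f′ : Fun d e} → (∀ x → f x ≡ f′ x) → (g : Fun d e) → inner d e f g ≡ inner d e f′ g
inner-congˡ d e f≗f′ g = ∑-cong (allWords d e) (λ x → cong (_* g x) (f≗f′ x))

inner-congʳ : (d e : ℕ) (f : Fun d e) {g g′ : Fun d e} → (∀ x → g x ≡ g′ x) → inner d e f g ≡ inner d e f g′
inner-congʳ d e f g≗g′ = ∑-cong (allWords d e) (λ x → cong (f x *_) (g≗g′ x))

inner-additive : (n : ℕ) {e : ℕ} (g h k G : Fin n → Fin e → ℚ) → ZeroMean g → ZeroMean h → ZeroMean G →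
                 fromℕ e * inner n e (λ x → additive g x * additive h x - additive k x) (additive G)
                 ≡ fromℕ e ^ n * ∑Fin (λ j → ∑Fin (λ a → (g j a * h j a - k j a) * G j a))
inner-additive zero    {e} g h k G _ _ _ = *-zeroʳ (fromℕ e)
inner-additive (suc m) {e} g h k G g0 h0 G0 = begin
  E * ∑Word (suc m) (λ x → Q x * additive G x)
    ≡⟨ cong (E *_) (∑Word-suc m (λ x → Q x * additive G x)) ⟩
  E * ∑Fin (λ a → ∑Word m (λ y → Q (a ∷ y) * (G zero a + W y)))
    ≡⟨ cong (E *_) (∑∑-*-split (allFin e) (allWords m e) (λ a y → Q (a ∷ y)) (G zero) W) ⟩
  E * (∑Fin (λ a → G zero a * ∑Word m (λ y → Q (a ∷ y))) + ∑Word m (λ y → W y * ∑Fin (λ a → Q (a ∷ y))))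
    ≡⟨ cong (E *_) (cong₂ _+_ rows columns) ⟩
  E * (E ^ m * ∑Fin T₀ + E * inner m e Q′ W)
    ≡⟨ cong (λ t → E * (E ^ m * ∑Fin T₀ + t))
            (inner-additive m (g ∘ suc) (h ∘ suc) (k ∘ suc) (G ∘ suc) (g0 ∘ suc) (h0 ∘ suc) (G0 ∘ suc)) ⟩
  E * (E ^ m * ∑Fin T₀ + E ^ m * R)
    ≡⟨ factor E (E ^ m) (∑Fin T₀) R ⟩
  E ^ suc m * (∑Fin T₀ + R)
    ≡⟨ cong (E ^ suc m *_) (∑Fin-suc (λ j → ∑Fin (λ a → (g j a * h j a - k j a) * G j a))) ⟨
  E ^ suc m * ∑Fin (λ j → ∑Fin (λ a → (g j a * h j a - k j a) * G j a)) ∎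
  where
  E : ℚ
  E = fromℕ e

  Q : Fun (suc m) e
  Q x = additive g x * additive h x - additive k x

  Q′ : Fun m e
  Q′ y = additive (g ∘ suc) y * additive (h ∘ suc) y - additive (k ∘ suc) y

  W : Fun m e
  W = additive (G ∘ suc)

  c : Fin e → ℚ
  c a = g zero a * h zero a - k zero a

  T₀ : Fin e → ℚ
  T₀ a = c a * G zero a

  R : ℚ
  R = ∑Fin (λ j → ∑Fin (λ a → (g (suc j) a * h (suc j) a - k (suc j) a) * G (suc j) a))

  factor : ∀ E P S R → E * (P * S + P * R) ≡ E * P * (S + R)
  factor = solve-∀ ℚ-ring

  rows : ∑Fin (λ a → G zero a * ∑Word m (λ y → Q (a ∷ y))) ≡ E ^ m * ∑Fin T₀
  rows = begin
    ∑Fin (λ a → G zero a * ∑Word m (λ y → Q (a ∷ y)))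
      ≡⟨ ∑-cong (allFin e) (λ a → cong (G zero a *_) (row-sum a)) ⟩
    ∑Fin (λ a → G zero a * (E ^ m * c a + ∑Word m Q′))
      ≡⟨ ∑-*-affine (allFin e) (G zero) c (E ^ m) (∑Word m Q′) (G0 zero) ⟩
    E ^ m * ∑Fin T₀ ∎
    where
    row-sum : ∀ a → ∑Word m (λ y → Q (a ∷ y)) ≡ E ^ m * c a + ∑Word m Q′
    row-sum a = trans (∑-shiftedProduct (allWords m e) (g zero a) (h zero a) (k zero a)
                         (additive (g ∘ suc)) (additive (h ∘ suc)) (additive (k ∘ suc))
                         (∑Word-additive m (g ∘ suc) (g0 ∘ suc)) (∑Word-additive m (h ∘ suc) (h0 ∘ suc)))
                      (cong (_+ ∑Word m Q′) (∑Word-const m e (c a)))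

  columns : ∑Word m (λ y → W y * ∑Fin (λ a → Q (a ∷ y))) ≡ E * inner m e Q′ W
  columns = begin
    ∑Word m (λ y → W y * ∑Fin (λ a → Q (a ∷ y)))
      ≡⟨ ∑-cong (allWords m e) (λ y → cong (W y *_) (column-sum y)) ⟩
    ∑Word m (λ y → W y * (E * Q′ y + ∑Fin c))
      ≡⟨ ∑-*-affine (allWords m e) W Q′ E (∑Fin c) (∑Word-additive m (G ∘ suc) (G0 ∘ suc)) ⟩
    E * inner m e Q′ W ∎
    where
    swap : ∀ p u q v r w → (p + u) * (q + v) - (r + w) ≡ (u + p) * (v + q) - (w + r)
    swap = solve-∀ ℚ-ring
    column-sum : ∀ y → ∑Fin (λ a → Q (a ∷ y)) ≡ E * Q′ y + ∑Fin c
    column-sum y = begin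
      ∑Fin (λ a → Q (a ∷ y))
        ≡⟨ ∑-cong (allFin e) (λ a → swap (g zero a) X (h zero a) Y (k zero a) Z) ⟩
      ∑Fin (λ a → (X + g zero a) * (Y + h zero a) - (Z + k zero a))
        ≡⟨ ∑-shiftedProduct (allFin e) X Y Z (g zero) (h zero) (k zero) (g0 zero) (h0 zero) ⟩
      ∑Fin {e} (λ _ → X * Y - Z) + ∑Fin c
        ≡⟨ cong (_+ ∑Fin c) (∑Fin-const e (X * Y - Z)) ⟩
      E * Q′ y + ∑Fin c ∎
      where
      X Y Z : ℚ
      X = additive (g ∘ suc) y
      Y = additive (h ∘ suc) y
      Z = additive (k ∘ suc) y

inner-additive-single : (n : ℕ) {e : ℕ} (g h k : Fin n → Fin e → ℚ) → ZeroMean g → ZeroMean h →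
                        (i : Fin n) (q : Fin e → ℚ) → ∑Fin q ≡ 0ℚ →
                        fromℕ e * inner n e (λ x → additive g x * additive h x - additive k x)
                                            (additive (single i q))
                        ≡ fromℕ e ^ n * ∑Fin (λ a → (g i a * h i a - k i a) * q a)
inner-additive-single n {e} g h k g0 h0 i q ∑q≡0 =
  trans (inner-additive n g h k (single i q) g0 h0 (single-zeroMean i q ∑q≡0))
        (cong (fromℕ e ^ n *_) (trans (∑Fin-point (λ j → ∑Fin (λ a → D j a * single i q j a)) i off-i) at-i))
  where
  D : Fin n → Fin e → ℚ
  D j a = g j a * h j a - k j a
  off-i : ∀ j → j ≢ i → ∑Fin (λ a → D j a * single i q j a) ≡ 0ℚ
  off-i j j≢i = ∑-vanishes (allFin e) (λ a →
    trans (cong (λ t → D j a * t a) (updateAt-minimal j i {λ _ → q} (λ _ _ → 0ℚ) j≢i)) (*-zeroʳ (D j a)))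
  at-i : ∑Fin (λ a → D i a * single i q i a) ≡ ∑Fin (λ a → D i a * q a)
  at-i = cong (λ t → ∑Fin (λ a → D i a * t a)) (updateAt-updates i {λ _ → q} (λ _ _ → 0ℚ))

-- Spectrum of H(d,e) for a nonempty alphabet

module Spectrum (k : ℕ) where

  e : ℕ
  e = suc k

  E : ℚ
  E = fromℕ e

  instance
    E-positive : Positive E
    E-positive = pos+nonNeg⇒pos 1ℚ (fromℕ k) {{fromℕ-nonNegative k}}

    E-nonZero : NonZero E
    E-nonZero = pos⇒nonZero E

  E^-nonZero : (n : ℕ) → NonZero (E ^ n)
  E^-nonZero n = pos⇒nonZero (E ^ n) {{positive-power n}}
    where
    positive-power : (n : ℕ) → Positive (E ^ n)
    positive-power zero    = _
    positive-power (suc n) = pos*pos⇒pos E (E ^ n) {{positive-power n}}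

  mean : (Fin e → ℚ) → ℚ
  mean q = 1/ E * ∑Fin q

  centre : (Fin e → ℚ) → Fin e → ℚ
  centre q a = q a - mean q

  E*mean : (q : Fin e → ℚ) → E * mean q ≡ ∑Fin q
  E*mean q = begin
    E * (1/ E * ∑Fin q)  ≡⟨ *-assoc E (1/ E) (∑Fin q) ⟨
    E * 1/ E * ∑Fin q    ≡⟨ cong (_* ∑Fin q) (*-inverseʳ E) ⟩
    1ℚ * ∑Fin q          ≡⟨ *-identityˡ (∑Fin q) ⟩
    ∑Fin q               ∎

  mean-const : (c : ℚ) → mean (λ _ → c) ≡ c
  mean-const c = begin
    1/ E * ∑Fin {e} (λ _ → c)  ≡⟨ cong (1/ E *_) (∑Fin-const e c) ⟩
    1/ E * (E * c)             ≡⟨ *-assoc (1/ E) E c ⟨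
    1/ E * E * c               ≡⟨ cong (_* c) (*-inverseˡ E) ⟩
    1ℚ * c                     ≡⟨ *-identityˡ c ⟩
    c                          ∎

  mean-+ : (p q : Fin e → ℚ) → mean (λ a → p a + q a) ≡ mean p + mean q
  mean-+ p q = trans (cong (1/ E *_) (∑-+ (allFin e) p q)) (*-distribˡ-+ (1/ E) (∑Fin p) (∑Fin q))

  mean-*ˡ : (c : ℚ) (q : Fin e → ℚ) → mean (λ a → c * q a) ≡ c * mean q
  mean-*ˡ c q = trans (cong (1/ E *_) (∑-*ˡ (allFin e) c q)) (swap (1/ E) c (∑Fin q))
    where
    swap : ∀ r c s → r * (c * s) ≡ c * (r * s)
    swap = solve-∀ ℚ-ring

  ∑Fin-centre : (q : Fin e → ℚ) → ∑Fin (centre q) ≡ 0ℚ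
  ∑Fin-centre q = begin
    ∑Fin (λ a → q a - mean q)          ≡⟨ ∑-- (allFin e) q (λ _ → mean q) ⟩
    ∑Fin q - ∑Fin {e} (λ _ → mean q)   ≡⟨ cong (_-_ (∑Fin q)) (trans (∑Fin-const e (mean q)) (E*mean q)) ⟩
    ∑Fin q - ∑Fin q                    ≡⟨ +-inverseʳ (∑Fin q) ⟩
    0ℚ                                 ∎

  centre-cong : {p q : Fin e → ℚ} → (∀ a → p a ≡ q a) → ∀ a → centre p a ≡ centre q a
  centre-cong p≗q a = cong₂ _-_ (p≗q a) (cong (1/ E *_) (∑-cong (allFin e) p≗q))

  centre-linear : (r s : ℚ) (p q : Fin e → ℚ) (a : Fin e) →
                  centre (λ b → r * p b + s * q b) a ≡ r * centre p a + s * centre q a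
  centre-linear r s p q a = begin
    r * p a + s * q a - mean (λ b → r * p b + s * q b)
      ≡⟨ cong (_-_ (r * p a + s * q a)) (trans (mean-+ (λ b → r * p b) (λ b → s * q b))
                                            (cong₂ _+_ (mean-*ˡ r p) (mean-*ˡ s q))) ⟩
    r * p a + s * q a - (r * mean p + s * mean q)
      ≡⟨ regroup r s (p a) (q a) (mean p) (mean q) ⟩
    r * (p a - mean p) + s * (q a - mean q) ∎
    where
    regroup : ∀ r s x y m n → r * x + s * y - (r * m + s * n) ≡ r * (x - m) + s * (y - n)
    regroup = solve-∀ ℚ-ring

  centre-shift : (q : Fin e → ℚ) (c : ℚ) (a : Fin e) → centre (λ b → q b + c) a ≡ centre q a
  centre-shift q c a = begin
    q a + c - mean (λ b → q b + c)
      ≡⟨ cong (_-_ (q a + c)) (trans (mean-+ q (λ _ → c)) (cong (mean q +_) (mean-const c))) ⟩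
    q a + c - (mean q + c)
      ≡⟨ cancel (q a) c (mean q) ⟩
    q a - mean q ∎
    where
    cancel : ∀ x c m → x + c - (m + c) ≡ x - m
    cancel = solve-∀ ℚ-ring

  centre-zeroMean : (q : Fin e → ℚ) → ∑Fin q ≡ 0ℚ → ∀ a → centre q a ≡ q a
  centre-zeroMean q ∑q≡0 a = begin
    q a - 1/ E * ∑Fin q ≡⟨ cong (λ t → q a - 1/ E * t) ∑q≡0 ⟩
    q a - 1/ E * 0ℚ     ≡⟨ cong (_-_ (q a)) (*-zeroʳ (1/ E)) ⟩
    q a - 0ℚ            ≡⟨ +-identityʳ (q a) ⟩
    q a                 ∎

  -- θ₀ d = d(e − 1) is the valency of H(d,e) and θ₁ d = θ₀ d − e the next eigenvalue.
  θ₀ : ℕ → ℚ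
  θ₀ zero    = 0ℚ
  θ₀ (suc d) = θ₀ d + (E - 1ℚ)

  θ₁ : ℕ → ℚ
  θ₁ d = θ₀ d - E

  θ₁<θ₀ : (d : ℕ) → θ₁ d < θ₀ d
  θ₁<θ₀ d = <-respʳ-≡ (p-q+q≡p (θ₀ d) E) (<-respˡ-≡ (+-identityʳ (θ₁ d)) (+-monoʳ-< (θ₁ d) (positive⁻¹ E)))

  θ₀-pred : (d : ℕ) → θ₀ (suc d) - (E - 1ℚ) ≡ θ₀ d
  θ₀-pred d = p+q-q≡p (θ₀ d) (E - 1ℚ)

  θ₁-pred : (d : ℕ) → θ₁ (suc d) - (E - 1ℚ) ≡ θ₁ d
  θ₁-pred d = shift (θ₀ d) E
    where
    shift : ∀ t c → t + (c - 1ℚ) - c - (c - 1ℚ) ≡ t - c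
    shift = solve-∀ ℚ-ring

  θ₁+1≡θ₀ : (d : ℕ) → θ₁ (suc d) + 1ℚ ≡ θ₀ d
  θ₁+1≡θ₀ d = shift (θ₀ d) E
    where
    shift : ∀ t c → t + (c - 1ℚ) - c + 1ℚ ≡ t
    shift = solve-∀ ℚ-ring

  fibre : {d : ℕ} → Fun (suc d) e → Word d e → Fin e → ℚ
  fibre f x b = f (b ∷ x)

  fibreMean : {d : ℕ} → Fun (suc d) e → Fun d e
  fibreMean f x = mean (fibre f x)

  deviation : {d : ℕ} → Fun (suc d) e → Fin e → Fun d e
  deviation f a x = centre (fibre f x) a

  deviation+fibreMean : {d : ℕ} (f : Fun (suc d) e) (a : Fin e) (x : Word d e) →
                        f (a ∷ x) ≡ deviation f a x + fibreMean f x
  deviation+fibreMean f a x = sym (p-q+q≡p (f (a ∷ x)) (fibreMean f x))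

  module _ {d : ℕ} {ν : ℚ} {f : Fun (suc d) e} (eig : IsEigen (suc d) e ν f) where

    adj-slice : (b : Fin e) (x : Word d e) →
                adj d e (λ y → f (b ∷ y)) x ≡ (ν + 1ℚ) * f (b ∷ x) - ∑Fin (fibre f x)
    adj-slice b x = begin
      T                    ≡⟨ isolate S F T ⟩
      S - F + T - S + F    ≡⟨ cong (λ t → t - S + F) (trans (sym (adj-cons d e f b x)) (eig (b ∷ x))) ⟩
      ν * F - S + F        ≡⟨ collect ν F S ⟩
      (ν + 1ℚ) * F - S     ∎
      where
      T S F : ℚ
      T = adj d e (λ y → f (b ∷ y)) x
      S = ∑Fin (fibre f x)
      F = f (b ∷ x)
      isolate : ∀ s t a → a ≡ s - t + a - s + t
      isolate = solve-∀ ℚ-ring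
      collect : ∀ ν t s → ν * t - s + t ≡ (ν + 1ℚ) * t - s
      collect = solve-∀ ℚ-ring

    fibreMean-eigen : IsEigen d e (ν - (E - 1ℚ)) (fibreMean f)
    fibreMean-eigen x = begin
      ∑ (neighbours x) (λ y → 1/ E * ∑Fin (fibre f y))
        ≡⟨ ∑-*ˡ (neighbours x) (1/ E) (λ y → ∑Fin (fibre f y)) ⟩
      1/ E * ∑ (neighbours x) (λ y → ∑Fin (fibre f y))
        ≡⟨ cong (1/ E *_) (∑-comm (neighbours x) (allFin e) (λ y b → f (b ∷ y))) ⟩
      1/ E * ∑Fin (λ b → adj d e (λ y → f (b ∷ y)) x)
        ≡⟨ cong (1/ E *_) (∑-cong (allFin e) (λ b → adj-slice b x)) ⟩
      1/ E * ∑Fin (λ b → (ν + 1ℚ) * f (b ∷ x) - S)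
        ≡⟨ cong (1/ E *_) (∑-- (allFin e) (λ b → (ν + 1ℚ) * f (b ∷ x)) (λ _ → S)) ⟩
      1/ E * (∑Fin (λ b → (ν + 1ℚ) * f (b ∷ x)) - ∑Fin {e} (λ _ → S))
        ≡⟨ cong (1/ E *_) (cong₂ _-_ (∑-*ˡ (allFin e) (ν + 1ℚ) (fibre f x)) (∑Fin-const e S)) ⟩
      1/ E * ((ν + 1ℚ) * S - E * S)
        ≡⟨ factor (1/ E) ν E S ⟩
      (ν - (E - 1ℚ)) * (1/ E * S) ∎
      where
      S : ℚ
      S = ∑Fin (fibre f x)
      factor : ∀ r ν c s → r * ((ν + 1ℚ) * s - c * s) ≡ (ν - (c - 1ℚ)) * (r * s)
      factor = solve-∀ ℚ-ring

    deviation-eigen : (a : Fin e) → IsEigen d e (ν + 1ℚ) (deviation f a)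
    deviation-eigen a x = begin
      ∑ (neighbours x) (λ y → f (a ∷ y) - fibreMean f y)
        ≡⟨ ∑-- (neighbours x) (λ y → f (a ∷ y)) (fibreMean f) ⟩
      adj d e (λ y → f (a ∷ y)) x - adj d e (fibreMean f) x
        ≡⟨ cong₂ _-_ (adj-slice a x) (fibreMean-eigen x) ⟩
      (ν + 1ℚ) * f (a ∷ x) - ∑Fin (fibre f x) - (ν - (E - 1ℚ)) * m
        ≡⟨ cong (λ t → (ν + 1ℚ) * f (a ∷ x) - t - (ν - (E - 1ℚ)) * m) (E*mean (fibre f x)) ⟨
      (ν + 1ℚ) * f (a ∷ x) - E * m - (ν - (E - 1ℚ)) * m
        ≡⟨ factor ν (f (a ∷ x)) E m ⟩
      (ν + 1ℚ) * (f (a ∷ x) - m) ∎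
      where
      m : ℚ
      m = fibreMean f x
      factor : ∀ ν t c m → (ν + 1ℚ) * t - c * m - (ν - (c - 1ℚ)) * m ≡ (ν + 1ℚ) * (t - m)
      factor = solve-∀ ℚ-ring

  eigen₀-vanishes : {ν : ℚ} (f : Fun 0 e) → IsEigen 0 e ν f → ν ≢ 0ℚ → f [] ≡ 0ℚ
  eigen₀-vanishes {ν} f eig ν≢0 = r*p≡0⇒p≡0 ν {{≢-nonZero ν≢0}} (sym (eig []))

  -- The deviations and the fibre mean of such an f lie in the gap again, one dimension lower.
  spectral-gap : (d : ℕ) {ν : ℚ} (f : Fun d e) → IsEigen d e ν f → θ₁ d < ν → ν ≢ θ₀ d → ∀ x → f x ≡ 0ℚ
  deviation-vanishes : (d : ℕ) {ν : ℚ} (f : Fun (suc d) e) → IsEigen (suc d) e ν f → θ₁ (suc d) < ν →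
                       ∀ a x → deviation f a x ≡ 0ℚ

  spectral-gap zero    f eig _ ν≢θ₀ [] = eigen₀-vanishes f eig ν≢θ₀
  spectral-gap (suc d) {ν} f eig θ₁<ν ν≢θ₀ (a ∷ x) = begin
    f (a ∷ x)
      ≡⟨ deviation+fibreMean f a x ⟩
    deviation f a x + fibreMean f x
      ≡⟨ cong₂ _+_ (deviation-vanishes d f eig θ₁<ν a x)
                   (spectral-gap d (fibreMean f) (fibreMean-eigen {ν = ν} eig) below off-top x) ⟩
    0ℚ ∎
    where
    below : θ₁ d < ν - (E - 1ℚ)
    below = <-respˡ-≡ (θ₁-pred d) (+-monoˡ-< (- (E - 1ℚ)) θ₁<ν)
    off-top : ν - (E - 1ℚ) ≢ θ₀ d
    off-top eq = ν≢θ₀ (trans (sym (p-q+q≡p ν (E - 1ℚ))) (cong (_+ (E - 1ℚ)) eq))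

  deviation-vanishes d {ν} f eig θ₁<ν a =
    spectral-gap d (deviation f a) (deviation-eigen {ν = ν} eig a)
                 (<-trans (θ₁<θ₀ d) θ₀<ν+1) (<⇒≢ θ₀<ν+1 ∘ sym)
    where
    θ₀<ν+1 : θ₀ d < ν + 1ℚ
    θ₀<ν+1 = <-respˡ-≡ (θ₁+1≡θ₀ d) (+-monoˡ-< 1ℚ θ₁<ν)

  top-eigenvector-constant : (d : ℕ) (f : Fun d e) → IsEigen d e (θ₀ d) f → ∀ x y → f x ≡ f y
  top-eigenvector-constant zero    f eig [] [] = refl
  top-eigenvector-constant (suc d) f eig (a ∷ x) (b ∷ y) = begin
    f (a ∷ x)
      ≡⟨ deviation+fibreMean f a x ⟩
    deviation f a x + fibreMean f x
      ≡⟨ cong₂ _+_ (vanishes a x) (top-eigenvector-constant d (fibreMean f) fibreMean-eig x y) ⟩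
    0ℚ + fibreMean f y
      ≡⟨ cong (_+ fibreMean f y) (vanishes b y) ⟨
    deviation f b y + fibreMean f y
      ≡⟨ deviation+fibreMean f b y ⟨
    f (b ∷ y) ∎
    where
    vanishes : ∀ a x → deviation f a x ≡ 0ℚ
    vanishes = deviation-vanishes d f eig (θ₁<θ₀ (suc d))
    fibreMean-eig : IsEigen d e (θ₀ d) (fibreMean f)
    fibreMean-eig =
      subst (λ μ → IsEigen d e μ (fibreMean f)) (θ₀-pred d) (fibreMean-eigen {ν = θ₀ (suc d)} eig)

  origin : (d : ℕ) → Word d e
  origin d = replicate d zero

  second-eigenvector-additive : (d : ℕ) (f : Fun d e) → IsEigen d e (θ₁ d) f →
                                Σ (Fin d → Fin e → ℚ) λ g → ZeroMean g × (∀ x → f x ≡ additive g x)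
  second-eigenvector-additive zero    f eig =
    (λ ()) , (λ ()) , λ { [] → eigen₀-vanishes f eig (<⇒≢ (θ₁<θ₀ 0)) }
  second-eigenvector-additive (suc d) f eig = g , g-zeroMean , f≗additive
    where
    fibreMean-additive : Σ (Fin d → Fin e → ℚ) λ g → ZeroMean g × (∀ x → fibreMean f x ≡ additive g x)
    fibreMean-additive = second-eigenvector-additive d (fibreMean f)
      (subst (λ μ → IsEigen d e μ (fibreMean f)) (θ₁-pred d) (fibreMean-eigen {ν = θ₁ (suc d)} eig))

    deviation-constant : ∀ a x → deviation f a x ≡ deviation f a (origin d)
    deviation-constant a x = top-eigenvector-constant d (deviation f a)
      (subst (λ μ → IsEigen d e μ (deviation f a)) (θ₁+1≡θ₀ d) (deviation-eigen {ν = θ₁ (suc d)} eig a))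
      x (origin d)

    g : Fin (suc d) → Fin e → ℚ
    g zero    a = deviation f a (origin d)
    g (suc i) = proj₁ fibreMean-additive i

    g-zeroMean : ZeroMean g
    g-zeroMean zero    = ∑Fin-centre (fibre f (origin d))
    g-zeroMean (suc i) = proj₁ (proj₂ fibreMean-additive) i

    f≗additive : ∀ x → f x ≡ additive g x
    f≗additive (a ∷ x) = trans (deviation+fibreMean f a x)
                               (cong₂ _+_ (deviation-constant a x) (proj₂ (proj₂ fibreMean-additive) x))

  constant-eigen : (d : ℕ) (c : ℚ) → IsEigen d e (θ₀ d) (λ _ → c)
  constant-eigen zero    c [] = sym (*-zeroˡ c)
  constant-eigen (suc d) c (a ∷ x) = begin
    adj (suc d) e (λ _ → c) (a ∷ x)
      ≡⟨ adj-cons d e (λ _ → c) a x ⟩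
    ∑Fin {e} (λ _ → c) - c + adj d e (λ _ → c) x
      ≡⟨ cong₂ (λ s t → s - c + t) (∑Fin-const e c) (constant-eigen d c x) ⟩
    E * c - c + θ₀ d * c
      ≡⟨ collect E c (θ₀ d) ⟩
    (θ₀ d + (E - 1ℚ)) * c ∎
    where
    collect : ∀ E c t → E * c - c + t * c ≡ (t + (E - 1ℚ)) * c
    collect = solve-∀ ℚ-ring

  additive-eigen : (d : ℕ) (g : Fin d → Fin e → ℚ) → ZeroMean g → IsEigen d e (θ₁ d) (additive g)
  additive-eigen zero    g _          [] = sym (*-zeroʳ (θ₁ 0))
  additive-eigen (suc d) g g-zeroMean (a ∷ x) = begin
    adj (suc d) e (additive g) (a ∷ x)
      ≡⟨ adj-cons d e (additive g) a x ⟩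
    ∑Fin (λ b → g zero b + X) - (p + X) + adj d e (λ y → p + additive (g ∘ suc) y) x
      ≡⟨ cong₂ (λ s t → s - (p + X) + t) column row ⟩
    E * X - (p + X) + (θ₀ d * p + θ₁ d * X)
      ≡⟨ collect E p X (θ₀ d) ⟩
    θ₁ (suc d) * (p + X) ∎
    where
    p X : ℚ
    p = g zero a
    X = additive (g ∘ suc) x
    column : ∑Fin (λ b → g zero b + X) ≡ E * X
    column = begin
      ∑Fin (λ b → g zero b + X)             ≡⟨ ∑-+ (allFin e) (g zero) (λ _ → X) ⟩
      ∑Fin (g zero) + ∑Fin {e} (λ _ → X)    ≡⟨ cong₂ _+_ (g-zeroMean zero) (∑Fin-const e X) ⟩
      0ℚ + E * X                            ≡⟨ +-identityˡ (E * X) ⟩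
      E * X                                 ∎
    row : adj d e (λ y → p + additive (g ∘ suc) y) x ≡ θ₀ d * p + θ₁ d * X
    row = trans (∑-+ (neighbours x) (λ _ → p) (additive (g ∘ suc)))
                (cong₂ _+_ (constant-eigen d p x) (additive-eigen d (g ∘ suc) (g-zeroMean ∘ suc) x))
    collect : ∀ E p X t → E * X - (p + X) + (t * p + (t - E) * X) ≡ (t + (E - 1ℚ) - E) * (p + X)
    collect = solve-∀ ℚ-ring

  eigenvalue>θ₁⇒≡θ₀ : {d : ℕ} {ν : ℚ} → IsEigenvalue d e ν → θ₁ d < ν → ν ≡ θ₀ d
  eigenvalue>θ₁⇒≡θ₀ {d} {ν} (f , eig , x , fx≢0) θ₁<ν with ν ≟ θ₀ d
  ... | yes ν≡θ₀ = ν≡θ₀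
  ... | no  ν≢θ₀ = contradiction (spectral-gap d f eig θ₁<ν ν≢θ₀ x) fx≢0

  component : {d : ℕ} → Fun d e → Fin d → Fin e → ℚ
  component u i = centre (λ a → u (origin _ [ i ]≔ a))

  component-cong : {d : ℕ} {u v : Fun d e} → (∀ x → u x ≡ v x) → ∀ i a → component u i a ≡ component v i a
  component-cong u≗v i = centre-cong (λ a → u≗v _)

  component-zeroMean : {d : ℕ} (u : Fun d e) → ZeroMean (component u)
  component-zeroMean {d} u i = ∑Fin-centre (λ a → u (origin d [ i ]≔ a))

  component-additive : {d : ℕ} (g : Fin d → Fin e → ℚ) → ZeroMean g →
                       ∀ i a → component (additive g) i a ≡ g i a
  component-additive {d} g g-zeroMean i a = begin
    centre (λ b → additive g (origin d [ i ]≔ b)) a ≡⟨ centre-cong (additive-update g (origin d) i) a ⟩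
    centre (λ b → g i b + C) a                      ≡⟨ centre-shift (g i) C a ⟩
    centre (g i) a                                  ≡⟨ centre-zeroMean (g i) (g-zeroMean i) a ⟩
    g i a                                           ∎
    where
    C : ℚ
    C = additive g (origin d) - g i (lookup (origin d) i)

-- The eigenspace V₁ for an alphabet of at least two letters

module SecondEigenspace (k : ℕ) where

  open Spectrum (suc k)

  δ : Fin e → ℚ
  δ zero          = 1ℚ
  δ (suc zero)    = - 1ℚ
  δ (suc (suc _)) = 0ℚ

  ∑Fin-δ : ∑Fin δ ≡ 0ℚ
  ∑Fin-δ = begin
    ∑Fin δ                                  ≡⟨ ∑Fin-suc δ ⟩
    1ℚ + ∑Fin (δ ∘ suc)                     ≡⟨ cong (1ℚ +_) (∑Fin-suc (δ ∘ suc)) ⟩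
    1ℚ + (- 1ℚ + ∑Fin {k} (λ _ → 0ℚ))       ≡⟨ cong (λ t → 1ℚ + (- 1ℚ + t)) (∑-zero (allFin k)) ⟩
    0ℚ                                      ∎

  θ₀-isEigenvalue : (d : ℕ) → IsEigenvalue d e (θ₀ d)
  θ₀-isEigenvalue d = (λ _ → 1ℚ) , constant-eigen d 1ℚ , origin d , λ ()

  θ₁-isEigenvalue : (d : ℕ) → IsEigenvalue (suc d) e (θ₁ (suc d))
  θ₁-isEigenvalue d = additive (single zero δ)
                    , additive-eigen (suc d) (single zero δ) (single-zeroMean zero δ ∑Fin-δ)
                    , origin (suc d)
                    , λ eq → 1≢0 (trans (sym (cong (1ℚ +_) (additive-zero (origin d)))) eq)

  θ₁-isSecondLargest : (d : ℕ) → IsSecondLargest (suc d) e (θ₁ (suc d))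
  θ₁-isSecondLargest d = θ₁-isEigenvalue d , θ₀ (suc d) , θ₀-isEigenvalue (suc d) , θ₁<θ₀ (suc d)
                       , λ ν ev θ₁<ν → eigenvalue>θ₁⇒≡θ₀ ev θ₁<ν

  isSecondLargest⇒≡θ₁ : {d : ℕ} {λ′ : ℚ} → IsSecondLargest (suc d) e λ′ → λ′ ≡ θ₁ (suc d)
  isSecondLargest⇒≡θ₁ {d} {λ′} (ev , μ , evμ , λ′<μ , only-μ) with <-cmp λ′ (θ₁ (suc d))
  ... | tri≈ _ λ′≡θ₁ _ = λ′≡θ₁
  ... | tri< λ′<θ₁ _ _ =
    contradiction (trans (only-μ _ (θ₁-isEigenvalue d) λ′<θ₁) (sym (only-μ _ (θ₀-isEigenvalue (suc d)) λ′<θ₀)))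
                  (<⇒≢ (θ₁<θ₀ (suc d)))
    where
    λ′<θ₀ : λ′ < θ₀ (suc d)
    λ′<θ₀ = <-trans λ′<θ₁ (θ₁<θ₀ (suc d))
  ... | tri> _ _ θ₁<λ′ =
    contradiction (trans (eigenvalue>θ₁⇒≡θ₀ ev θ₁<λ′) (sym (eigenvalue>θ₁⇒≡θ₀ evμ (<-trans θ₁<λ′ λ′<μ))))
                  (<⇒≢ λ′<μ)

  additive∈V₁ : {d : ℕ} (g : Fin (suc d) → Fin e → ℚ) → ZeroMean g → V₁ (suc d) e
  additive∈V₁ {d} g g-zeroMean =
    additive g , θ₁ (suc d) , θ₁-isSecondLargest d , additive-eigen (suc d) g g-zeroMean

  V₁⊆additive : {d : ℕ} (u : V₁ (suc d) e) →
                Σ (Fin (suc d) → Fin e → ℚ) λ g → ZeroMean g × (∀ x → proj₁ u x ≡ additive g x)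
  V₁⊆additive {d} (f , λ′ , second , eig) =
    second-eigenvector-additive (suc d) f (subst (λ μ → IsEigen (suc d) e μ f) (isSecondLargest⇒≡θ₁ second) eig)

  V₁-reconstruction : {d : ℕ} (u : V₁ (suc d) e) → ∀ x → proj₁ u x ≡ additive (component (proj₁ u)) x
  V₁-reconstruction u x with V₁⊆additive u
  ... | g , g-zeroMean , u≗g = trans (u≗g x) (additive-cong (λ i a →
          sym (trans (component-cong u≗g i a) (component-additive g g-zeroMean i a))) x)

  line : (q : Fin e → ℚ) → ∑Fin q ≡ 0ℚ → V₁ 1 e
  line q ∑q≡0 = additive∈V₁ (λ _ → q) (λ _ → ∑q≡0)

  componentV₁ : {d : ℕ} → V₁ (suc d) e → Fin (suc d) → V₁ 1 e
  componentV₁ u i = line (component (proj₁ u) i) (component-zeroMean (proj₁ u) i)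

  -- Test the Norton relation against the element of V₁ living on coordinate i alone.
  IsNorton⇒coordinatewise : {d : ℕ} (u v w : V₁ (suc d) e) → IsNorton (suc d) e u v w →
                            ∀ i (q : Fin e → ℚ) → ∑Fin q ≡ 0ℚ →
                            let U = component (proj₁ u); V = component (proj₁ v); W = component (proj₁ w)
                            in ∑Fin (λ a → (U i a * V i a - W i a) * q a) ≡ 0ℚ
  IsNorton⇒coordinatewise {d} u v w uv≡w i q ∑q≡0 = r*p≡0⇒p≡0 (E ^ suc d) {{E^-nonZero (suc d)}} (begin
    E ^ suc d * ∑Fin (λ a → (U i a * V i a - W i a) * q a)
      ≡⟨ inner-additive-single (suc d) U V W (component-zeroMean (proj₁ u)) (component-zeroMean (proj₁ v))
                               i q ∑q≡0 ⟨
    E * inner (suc d) e (λ x → additive U x * additive V x - additive W x) (additive (single i q))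
      ≡⟨ cong (E *_) (inner-congˡ (suc d) e reconstruct (additive (single i q))) ⟨
    E * inner (suc d) e (λ x → proj₁ u x * proj₁ v x - proj₁ w x) (additive (single i q))
      ≡⟨ cong (E *_) (uv≡w (additive∈V₁ (single i q) (single-zeroMean i q ∑q≡0))) ⟩
    E * 0ℚ
      ≡⟨ *-zeroʳ E ⟩
    0ℚ ∎)
    where
    U V W : Fin (suc d) → Fin e → ℚ
    U = component (proj₁ u)
    V = component (proj₁ v)
    W = component (proj₁ w)
    reconstruct : ∀ x → proj₁ u x * proj₁ v x - proj₁ w x ≡ additive U x * additive V x - additive W x
    reconstruct x =
      cong₂ _-_ (cong₂ _*_ (V₁-reconstruction u x) (V₁-reconstruction v x)) (V₁-reconstruction w x)

  coordinatewise⇒IsNorton : (p q r : Fin e → ℚ)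
                            (∑p≡0 : ∑Fin p ≡ 0ℚ) (∑q≡0 : ∑Fin q ≡ 0ℚ) (∑r≡0 : ∑Fin r ≡ 0ℚ) →
                            (∀ s → ∑Fin s ≡ 0ℚ → ∑Fin (λ a → (p a * q a - r a) * s a) ≡ 0ℚ) →
                            IsNorton 1 e (line p ∑p≡0) (line q ∑q≡0) (line r ∑r≡0)
  coordinatewise⇒IsNorton p q r ∑p≡0 ∑q≡0 _ pq≡r z = r*p≡0⇒p≡0 E (begin
    E * inner 1 e P (proj₁ z)
      ≡⟨ cong (E *_) (inner-congʳ 1 e P z≗single) ⟩
    E * inner 1 e P (additive (single zero s))
      ≡⟨ inner-additive-single 1 (λ _ → p) (λ _ → q) (λ _ → r) (λ _ → ∑p≡0) (λ _ → ∑q≡0) zero s ∑s≡0 ⟩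
    E ^ 1 * ∑Fin (λ a → (p a * q a - r a) * s a)
      ≡⟨ cong (E ^ 1 *_) (pq≡r s ∑s≡0) ⟩
    E ^ 1 * 0ℚ
      ≡⟨ *-zeroʳ (E ^ 1) ⟩
    0ℚ ∎)
    where
    P : Fun 1 e
    P x = additive (λ _ → p) x * additive (λ _ → q) x - additive (λ _ → r) x
    s : Fin e → ℚ
    s = component (proj₁ z) zero
    ∑s≡0 : ∑Fin s ≡ 0ℚ
    ∑s≡0 = component-zeroMean (proj₁ z) zero
    z≗single : ∀ x → proj₁ z x ≡ additive (single zero s) x
    z≗single x = trans (V₁-reconstruction z x) (additive-cong (λ { zero a → refl }) x)

  isomorphism : (d : ℕ) → AlgIsoToPower (suc d) e
  isomorphism d = record
    { φ        = componentV₁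
    ; φ-cong   = λ u v u≈v i → additive-cong (λ _ → component-cong u≈v i)
    ; φ-linear = φ-linear
    ; φ-inj    = φ-inj
    ; φ-surj   = φ-surj
    ; φ-mult   = φ-mult
    }
    where
    φ-mult : (u v w : V₁ (suc d) e) → IsNorton (suc d) e u v w →
             ∀ i → IsNorton 1 e (componentV₁ u i) (componentV₁ v i) (componentV₁ w i)
    φ-mult u v w uv≡w i =
      coordinatewise⇒IsNorton (component (proj₁ u) i) (component (proj₁ v) i) (component (proj₁ w) i)
        (component-zeroMean (proj₁ u) i) (component-zeroMean (proj₁ v) i) (component-zeroMean (proj₁ w) i)
        (IsNorton⇒coordinatewise u v w uv≡w i)

    φ-linear : (a b : ℚ) (u v w : V₁ (suc d) e) → (∀ x → proj₁ w x ≡ lin a (proj₁ u) b (proj₁ v) x) →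
               ∀ i y → proj₁ (componentV₁ w i) y
                       ≡ lin a (proj₁ (componentV₁ u i)) b (proj₁ (componentV₁ v i)) y
    φ-linear a b u v w w≈ i y = begin
      additive (λ _ → W i) y
        ≡⟨ additive-cong (λ _ c → trans (component-cong w≈ i c) (centre-linear a b _ _ c)) y ⟩
      additive (λ _ c → a * U i c + b * V i c) y
        ≡⟨ additive-linear a b (λ _ → U i) (λ _ → V i) y ⟩
      a * additive (λ _ → U i) y + b * additive (λ _ → V i) y ∎
      where
      U V W : Fin (suc d) → Fin e → ℚ
      U = component (proj₁ u)
      V = component (proj₁ v)
      W = component (proj₁ w)

    φ-inj : (u v : V₁ (suc d) e) → (∀ i → componentV₁ u i ≈V componentV₁ v i) → u ≈V v
    φ-inj u v φu≈φv x = begin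
      proj₁ u x                         ≡⟨ V₁-reconstruction u x ⟩
      additive (component (proj₁ u)) x  ≡⟨ additive-cong same-components x ⟩
      additive (component (proj₁ v)) x  ≡⟨ V₁-reconstruction v x ⟨
      proj₁ v x                         ∎
      where
      same-components : ∀ i a → component (proj₁ u) i a ≡ component (proj₁ v) i a
      same-components i a = trans (sym (+-identityʳ _)) (trans (φu≈φv i (a ∷ [])) (+-identityʳ _))

    φ-surj : (t : Fin (suc d) → V₁ 1 e) → Σ (V₁ (suc d) e) λ u → ∀ i → componentV₁ u i ≈V t i
    φ-surj t = additive∈V₁ h h-zeroMean , λ { i (a ∷ []) → begin
        component (additive h) i a + 0ℚ  ≡⟨ cong (_+ 0ℚ) (component-additive h h-zeroMean i a) ⟩
        h i a + 0ℚ                       ≡⟨ V₁-reconstruction (t i) (a ∷ []) ⟨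
        proj₁ (t i) (a ∷ [])             ∎ }
      where
      h : Fin (suc d) → Fin e → ℚ
      h i = component (proj₁ (t i)) zero
      h-zeroMean : ZeroMean h
      h-zeroMean i = component-zeroMean (proj₁ (t i)) zero

corollary3p4 : (d e : ℕ) → 1 ≤ d → 2 ≤ e → AlgIsoToPower d e
corollary3p4 zero    _             ()      _
corollary3p4 (suc d) zero          _       ()
corollary3p4 (suc d) (suc zero)    _       (s≤s ())
corollary3p4 (suc d) (suc (suc k)) _       _ = SecondEigenspace.isomorphism k d
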